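{- Let $G$ be a finite simple graph with vertex set $V(G)$ and edge set $E(G)$, and let $Q_G(u)$ be its skew characteristic polynomial. Then: (1) $\deg Q_G = |V(G)|$; (2) $Q_G$ contains only monomials $u^j$ with $j \equiv |V(G)| \pmod 2$ (it is even if $|V(G)|$ is even and odd if $|V(G)|$ is odd); (3) all nonzero coefficients of $Q_G$ are positive integers; (4) the leading coefficient of $Q_G$ is $1$, and the coefficient of $u^{|V(G)|-2}$ equals $|E(G)|$; (5) $Q_G(0)=\nu(G)$; (6) if $G = G_1 \sqcup G_2$ is a disjoint union of two graphs, then $Q_G = Q_{G_1}\cdot Q_{G_2}$; (7) if $G$ has a single vertex, then $Q_G(u)=u$.
   Context: For a finite simple graph $G$, its adjacency matrix $A_G$ is the symmetric $0/1$ matrix over the field $\mathbb{F}_2$ of two elements with $(i,j)$ entry $1$ iff $\{i,j\}\in E(G)$. The nondegeneracy $\nu(G)\in\{0,1\}\subset\mathbb{C}$ is $1$ if $A_G$ is nondegenerate (invertible) over $\mathbb{F}_2$ and $0$ otherwise; for the empty graph (no vertices) $\nu=1$. For $U\subseteq V(G)$, $G(U)$ denotes the subgraph induced on $U$. The skew characteristic polynomial of $G$ is $Q_G(u)=\sum_{k\ge 0} q_k(G)\,u^{|V(G)|-k}\in\mathbb{C}[u]$, where $q_k(G)=\sum_{U\subseteq V(G),\,|U|=k}\nu(G(U))$. -}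

module Defs where

open import Data.Bool using (Bool; true; false; _∧_; _∨_; _xor_; not; if_then_else_)
open import Data.Nat as ℕ using (ℕ; zero; suc; _∸_; _≤ᵇ_; _<ᵇ_)
open import Data.Integer as ℤ using (ℤ; +_)
open import Data.Fin using (Fin; toℕ; splitAt)
open import Data.Vec using (Vec; []; _∷_; lookup; tabulate)
open import Data.List as List using (List; []; _∷_; [_]; concatMap; filter; length; upTo; allFin)
open import Data.Sum using (_⊎_; inj₁; inj₂)
open import Relation.Binary.PropositionalEquality using (_≡_; refl)
import Data.Nat.ListAction
import Data.Bool.ListAction

record Graph (n : ℕ) : Set where
  field
    adj    : Fin n → Fin n → Bool
    sym    : ∀ i j → adj i j ≡ adj j i
    irrefl : ∀ i → adj i i ≡ false
open Graph public

edgeCount : ∀ {n} → Graph n → ℕ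
edgeCount {n} G =
  Data.Nat.ListAction.sum (concatMap (λ i → List.map (λ j → if (toℕ i <ᵇ toℕ j) ∧ adj G i j then 1 else 0)
                                      (allFin n))
                      (allFin n))

-- Linear algebra over F₂ = Bool (xor = +, ∧ = *)

-- all vectors of F₂ⁿ (equivalently all subsets of Fin n)
allVecs : (n : ℕ) → List (Vec Bool n)
allVecs zero    = [ [] ]
allVecs (suc n) = concatMap (λ v → (false ∷ v) ∷ (true ∷ v) ∷ []) (allVecs n)

xorSum : ∀ {n} → Vec Bool n → Bool
xorSum []       = false
xorSum (b ∷ bs) = b xor xorSum bs

isZero : ∀ {n} → Vec Bool n → Bool
isZero []       = true
isZero (b ∷ bs) = not b ∧ isZero bs

mulVec : ∀ {m} → (Fin m → Fin m → Bool) → Vec Bool m → Vec Bool m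
mulVec A x = tabulate λ i → xorSum (tabulate λ j → A i j ∧ lookup x j)

nondegenerate? : ∀ {m} → (Fin m → Fin m → Bool) → Bool
nondegenerate? {m} A = Data.Bool.ListAction.all (λ x → not (isZero (mulVec A x)) ∨ isZero x) (allVecs m)

ν : ∀ {m} → Graph m → ℤ
ν G = if nondegenerate? (adj G) then + 1 else + 0

-- Induced subgraphs G(U), U ⊆ V(G) given as a characteristic vector

members : ∀ {n} → Vec Bool n → List (Fin n)
members {n} U = filter (λ i → Data.Bool._≟_ (lookup U i) true) (allFin n)
  where import Data.Bool

card : ∀ {n} → Vec Bool n → ℕ
card []           = 0
card (true ∷ bs)  = suc (card bs)
card (false ∷ bs) = card bs

induced : ∀ {n} → Graph n → (U : Vec Bool n) → Graph (length (members U))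
induced G U = record
  { adj    = λ i j → adj G (List.lookup (members U) i) (List.lookup (members U) j)
  ; sym    = λ i j → sym G (List.lookup (members U) i) (List.lookup (members U) j)
  ; irrefl = λ i → irrefl G (List.lookup (members U) i)
  }

q : ∀ {n} → Graph n → ℕ → ℤ
q {n} G k = List.foldr ℤ._+_ (+ 0)
  (List.map (λ U → if card U ℕ.≡ᵇ k then ν (induced G U) else + 0) (allVecs n))

-- Polynomials in u with integer coefficients, as coefficient functions:
-- p j = coefficient of u^j.
Poly : Set
Poly = ℕ → ℤ

-- Q_G(u) = Σ_k q_k(G) u^(n-k); coefficient of u^j is q_(n-j)(G) for j ≤ n, else 0
Q : ∀ {n} → Graph n → Poly
Q {n} G j = if j ≤ᵇ n then q G (n ∸ j) else + 0

_*ₚ_ : Poly → Poly → Poly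
(p *ₚ r) m = List.foldr ℤ._+_ (+ 0) (List.map (λ i → p i ℤ.* r (m ∸ i)) (upTo (suc m)))

uₚ : Poly
uₚ j = if j ℕ.≡ᵇ 1 then + 1 else + 0

eval0 : Poly → ℤ
eval0 p = p 0

Degree : Poly → ℕ → Set
Degree p d = (p d ≡ + 0 → Data.Empty.⊥) Data.Product.× (∀ j → d ℕ.< j → p j ≡ + 0)
  where import Data.Empty; import Data.Product

combine : ∀ {a b} → Graph a → Graph b → Fin a ⊎ Fin b → Fin a ⊎ Fin b → Bool
combine G₁ G₂ (inj₁ i) (inj₁ j) = adj G₁ i j
combine G₁ G₂ (inj₂ i) (inj₂ j) = adj G₂ i j
combine G₁ G₂ (inj₁ i) (inj₂ j) = false
combine G₁ G₂ (inj₂ i) (inj₁ j) = false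

combine-sym : ∀ {a b} (G₁ : Graph a) (G₂ : Graph b) x y → combine G₁ G₂ x y ≡ combine G₁ G₂ y x
combine-sym G₁ G₂ (inj₁ i) (inj₁ j) = sym G₁ i j
combine-sym G₁ G₂ (inj₂ i) (inj₂ j) = sym G₂ i j
combine-sym G₁ G₂ (inj₁ i) (inj₂ j) = refl
combine-sym G₁ G₂ (inj₂ i) (inj₁ j) = refl

combine-irrefl : ∀ {a b} (G₁ : Graph a) (G₂ : Graph b) x → combine G₁ G₂ x x ≡ false
combine-irrefl G₁ G₂ (inj₁ i) = irrefl G₁ i
combine-irrefl G₁ G₂ (inj₂ i) = irrefl G₂ i

_⊔_ : ∀ {a b} → Graph a → Graph b → Graph (a ℕ.+ b)
_⊔_ {a} G₁ G₂ = record
  { adj    = λ i j → combine G₁ G₂ (splitAt a i) (splitAt a j)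
  ; sym    = λ i j → combine-sym G₁ G₂ (splitAt a i) (splitAt a j)
  ; irrefl = λ i → combine-irrefl G₁ G₂ (splitAt a i)
  }

module Submission where

-- Each coefficient of Q_G is the number of vertex sets U with |V ∖ U| = j whose induced adjacency
-- matrix is nondegenerate over F₂, which gives (3); (1), (4) and (5) are read off from U = ∅, from
-- |U| = 2 (an induced pair is nondegenerate iff it is an edge) and from U = V. Adjacency matrices are
-- alternating, and an alternating matrix of odd size has a nonzero kernel vector (eliminate a pivot
-- pair and recurse on the Schur complement), so only even |U| contribute: (2). For G₁ ⊔ G₂ each U
-- splits as U₁ ⊔ U₂ with block diagonal induced matrix, nondegenerate iff both blocks are; summing over
-- the splittings gives the Cauchy product (6).

open import Defs renaming (sym to adj-sym)
open import Algebra.Bundles using (CommutativeRing)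
open import Data.Bool using (Bool; true; false; _∧_; _∨_; _xor_; not; if_then_else_)
open import Data.Bool.Properties
  using (xor-∧-commutativeRing; xor-same; xor-comm; xor-assoc; xor-identityʳ; ∧-comm; ∧-zeroʳ; ∧-identityʳ; ∧-assoc;
         ∧-distribʳ-xor; ¬-not; T-≡; if-float; if-cong; if-cong-then; if-cong-else)
  renaming (_≟_ to _≟ᵇ_)
open import Data.Nat as ℕ using (ℕ; zero; suc; _+_; _*_; _∸_; _≤_; z≤n; s≤s; _≡ᵇ_; _≤ᵇ_; _<ᵇ_; _%_)
open import Data.Fin using (Fin; zero; suc; toℕ; cast; splitAt; join; _↑ˡ_; _↑ʳ_; punchIn; punchOut)
open import Data.Fin.Properties
  using (cast-is-id; splitAt-↑ˡ; splitAt-↑ʳ; join-splitAt; punchIn-punchOut; any?)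
  renaming (_≟_ to _≟ᶠ_)
open import Data.Vec using (Vec; []; _∷_; _++_; lookup; tabulate)
open import Data.Vec.Properties using (lookup∘tabulate)
import Data.Vec.Functional as Vector
open import Data.Vec.Functional.Properties using (lookup-++ˡ; lookup-++ʳ; insertAt-lookup; insertAt-punchIn)
open import Data.List as List using (List; []; _∷_; length)
open import Data.List.Properties
  using (length-map; length-++; length-tabulate; lookup-tabulate; map-tabulate; map-++; map-∘; map-id)
open import Function using (id; _∘_; Equivalence)
import Data.Bool.ListAction as BoolList
open import Data.Sum using (_⊎_; inj₁; inj₂; [_,_]′)
open import Data.Product using (Σ; ∃; _×_; _,_; proj₁; proj₂)
open import Data.Empty using (⊥-elim)
open import Relation.Nullary using (yes; no)
open import Relation.Binary.PropositionalEquality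
open import Data.Nat.DivMod using (m%n<n; %-distribˡ-+; m%n%n≡m%n)
open import Data.Nat.Properties
  using (+-suc; +-assoc; +-comm; +-identityʳ; *-comm; *-zeroʳ; *-distribˡ-+; ≤-refl; m≤n+m; m≤m+n;
         ≡ᵇ⇒≡; ≡⇒≡ᵇ; ≤ᵇ⇒≤; ≤⇒≤ᵇ; <⇒≱; ≰⇒>; m+n∸m≡n; m+n∸n≡m; m∸[m∸n]≡n; n∸n≡0; m∸n≤m;
         +-commutativeSemigroup; +-0-monoid)
open import Algebra.Properties.Monoid.Sum +-0-monoid
  using () renaming (sum to Σᶠ; sum-cong-≗ to Σᶠ-cong; sum-replicate-zero to Σᶠ-zero)
open import Algebra.Properties.CommutativeSemigroup +-commutativeSemigroup using () renaming (interchange to +-interchange)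
import Data.Nat.ListAction as NatList
open import Data.Nat.ListAction.Properties using (sum-++)
open import Data.Integer as ℤ using (ℤ)
open import Data.Integer.Properties using (pos-+; pos-*)

private
  module F₂ = CommutativeRing xor-∧-commutativeRing

  variable
    X Y : Set

open import Algebra.Properties.CommutativeMonoid.Sum F₂.+-commutativeMonoid
  using () renaming (sum to ⨁; sum-cong-≗ to ⨁-cong; sum-replicate-zero to ⨁-zero;
                     ∑-distrib-+ to ⨁-distrib-xor; sum-remove to ⨁-remove)
open import Algebra.Properties.Semiring.Sum F₂.semiring
  using () renaming (*-distribˡ-sum to ∧-distribˡ-⨁)

Bool-ext : ∀ {a b : Bool} → (a ≡ true → b ≡ true) → (b ≡ true → a ≡ true) → a ≡ b
Bool-ext {true}          a⇒b _ = sym (a⇒b refl)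
Bool-ext {false} {true}  _ b⇒a = b⇒a refl
Bool-ext {false} {false} _ _   = refl

∧-true : ∀ {a b} → a ∧ b ≡ true → a ≡ true × b ≡ true
∧-true {true} b≡true = refl , b≡true

-- Kernels of matrices over F₂

Mat : ℕ → Set
Mat m = Fin m → Fin m → Bool

⨁-false : ∀ {m} (f : Fin m → Bool) → (∀ i → f i ≡ false) → ⨁ f ≡ false
⨁-false {m} f f≡false = trans (⨁-cong f≡false) (⨁-zero m)

⨁-splitAt : ∀ a {b} (f : Fin (a + b) → Bool) → ⨁ f ≡ ⨁ (λ i → f (i ↑ˡ b)) xor ⨁ (λ j → f (a ↑ʳ j))
⨁-splitAt zero    f = refl
⨁-splitAt (suc a) f = trans (cong (f zero xor_) (⨁-splitAt a (λ i → f (suc i)))) (sym (xor-assoc (f zero) _ _))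

InKernel : ∀ {m} → Mat m → (Fin m → Bool) → Set
InKernel M x = ∀ i → ⨁ (λ j → M i j ∧ x j) ≡ false

KernelTrivial : ∀ {m} → Mat m → Set
KernelTrivial {m} M = ∀ (x : Fin m → Bool) → InKernel M x → ∀ j → x j ≡ false

NonzeroKernelVector : ∀ {m} → Mat m → Set
NonzeroKernelVector {m} M = Σ (Fin m → Bool) λ x → InKernel M x × ∃ λ j → x j ≡ true

isZero⇒lookup≡false : ∀ {m} (v : Vec Bool m) → isZero v ≡ true → ∀ i → lookup v i ≡ false
isZero⇒lookup≡false (false ∷ v) v≡0 zero    = refl
isZero⇒lookup≡false (false ∷ v) v≡0 (suc i) = isZero⇒lookup≡false v v≡0 i

lookup≡false⇒isZero : ∀ {m} (v : Vec Bool m) → (∀ i → lookup v i ≡ false) → isZero v ≡ true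
lookup≡false⇒isZero []      _        = refl
lookup≡false⇒isZero (b ∷ v) v[i]≡0 rewrite v[i]≡0 zero = lookup≡false⇒isZero v (λ i → v[i]≡0 (suc i))

lookup-mulVec : ∀ {m} (M : Mat m) (v : Vec Bool m) i → lookup (mulVec M v) i ≡ ⨁ (λ j → M i j ∧ lookup v j)
lookup-mulVec M v i = trans (lookup∘tabulate _ i) (xorSum-tabulate (λ j → M i j ∧ lookup v j))
  where
  xorSum-tabulate : ∀ {k} (f : Fin k → Bool) → xorSum (tabulate f) ≡ ⨁ f
  xorSum-tabulate {zero}  f = refl
  xorSum-tabulate {suc k} f = cong (f zero xor_) (xorSum-tabulate (λ j → f (suc j)))

all-allVecs-suc : ∀ {m} (p : Vec Bool (suc m) → Bool) →
  BoolList.all p (allVecs (suc m)) ≡ BoolList.all (λ v → p (false ∷ v) ∧ p (true ∷ v)) (allVecs m)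
all-allVecs-suc {m} p = go (allVecs m)
  where
  go : ∀ vs → BoolList.all p (List.concatMap (λ v → (false ∷ v) ∷ (true ∷ v) ∷ []) vs)
              ≡ BoolList.all (λ v → p (false ∷ v) ∧ p (true ∷ v)) vs
  go []       = refl
  go (v ∷ vs) = trans (sym (∧-assoc (p (false ∷ v)) _ _)) (cong ((p (false ∷ v) ∧ p (true ∷ v)) ∧_) (go vs))

all-allVecs⇒ : ∀ m (p : Vec Bool m → Bool) → BoolList.all p (allVecs m) ≡ true → ∀ v → p v ≡ true
all-allVecs⇒ zero    p all≡true []      = proj₁ (∧-true all≡true)
all-allVecs⇒ (suc m) p all≡true (b ∷ v) = pick b (all-allVecs⇒ m _ (trans (sym (all-allVecs-suc p)) all≡true) v)
  where
  pick : ∀ b → p (false ∷ v) ∧ p (true ∷ v) ≡ true → p (b ∷ v) ≡ true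
  pick false = proj₁ ∘ ∧-true
  pick true  = proj₂ ∘ ∧-true {p (false ∷ v)}

all-allVecs⇐ : ∀ m (p : Vec Bool m → Bool) → (∀ v → p v ≡ true) → BoolList.all p (allVecs m) ≡ true
all-allVecs⇐ zero    p p≡true rewrite p≡true [] = refl
all-allVecs⇐ (suc m) p p≡true = trans (all-allVecs-suc p)
  (all-allVecs⇐ m _ (λ v → cong₂ _∧_ (p≡true (false ∷ v)) (p≡true (true ∷ v))))

nondegenerate?⇒kernelTrivial : ∀ {m} (M : Mat m) → nondegenerate? M ≡ true → KernelTrivial M
nondegenerate?⇒kernelTrivial {m} M nd x x∈ker j =
  trans (sym (lookup∘tabulate x j))
        (isZero⇒lookup≡false (tabulate x) (implication Mx≡0 (all-allVecs⇒ m _ nd (tabulate x))) j)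
  where
  implication : ∀ {a b} → a ≡ true → (not a ∨ b) ≡ true → b ≡ true
  implication refl b≡true = b≡true
  Mx≡0 : isZero (mulVec M (tabulate x)) ≡ true
  Mx≡0 = lookup≡false⇒isZero (mulVec M (tabulate x)) λ i →
    trans (lookup-mulVec M (tabulate x) i) (trans (⨁-cong (λ j → cong (M i j ∧_) (lookup∘tabulate x j))) (x∈ker i))

kernelTrivial⇒nondegenerate? : ∀ {m} (M : Mat m) → KernelTrivial M → nondegenerate? M ≡ true
kernelTrivial⇒nondegenerate? {m} M trivial = all-allVecs⇐ m _ injective
  where
  injective : ∀ v → (not (isZero (mulVec M v)) ∨ isZero v) ≡ true
  injective v with isZero (mulVec M v) in Mv≡0
  ... | false = refl
  ... | true  = lookup≡false⇒isZero v (trivial (lookup v) λ i →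
                  trans (sym (lookup-mulVec M v i)) (isZero⇒lookup≡false (mulVec M v) Mv≡0 i))

kernelTrivial-cong : ∀ {m} {M M′ : Mat m} → (∀ i j → M i j ≡ M′ i j) → KernelTrivial M → KernelTrivial M′
kernelTrivial-cong M≡M′ trivial x x∈ker =
  trivial x λ i → trans (⨁-cong (λ j → cong (_∧ x j) (M≡M′ i j))) (x∈ker i)

nondegenerate?-cong : ∀ {m} {M M′ : Mat m} → (∀ i j → M i j ≡ M′ i j) → nondegenerate? M ≡ nondegenerate? M′
nondegenerate?-cong {M = M} {M′} M≡M′ = Bool-ext
  (λ nd → kernelTrivial⇒nondegenerate? M′ (kernelTrivial-cong M≡M′ (nondegenerate?⇒kernelTrivial M nd)))
  (λ nd → kernelTrivial⇒nondegenerate? M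
            (kernelTrivial-cong (λ i j → sym (M≡M′ i j)) (nondegenerate?⇒kernelTrivial M′ nd)))

nondegenerate?-cast : ∀ {m m′} (eq : m ≡ m′) {M : Mat m} {M′ : Mat m′} →
  (∀ i j → M i j ≡ M′ (cast eq i) (cast eq j)) → nondegenerate? M ≡ nondegenerate? M′
nondegenerate?-cast refl {M′ = M′} M≡M′ =
  nondegenerate?-cong λ i j → trans (M≡M′ i j) (cong₂ M′ (cast-is-id refl i) (cast-is-id refl j))

Fin-+-elim : ∀ {a b} (P : Fin (a + b) → Set) → (∀ i → P (i ↑ˡ b)) → (∀ j → P (a ↑ʳ j)) → ∀ l → P l
Fin-+-elim {a} {b} P left right l = subst P (join-splitAt a b l) (onSplit (splitAt a l))
  where
  onSplit : ∀ s → P (join a b s)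
  onSplit (inj₁ i) = left i
  onSplit (inj₂ j) = right j

module BlockDiagonal {a b} (C : Fin a ⊎ Fin b → Fin a ⊎ Fin b → Bool)
                     (C₁₂≡false : ∀ i j → C (inj₁ i) (inj₂ j) ≡ false)
                     (C₂₁≡false : ∀ i j → C (inj₂ i) (inj₁ j) ≡ false) where

  blocks : Mat (a + b)
  blocks i j = C (splitAt a i) (splitAt a j)

  block₁ : Mat a
  block₁ i j = C (inj₁ i) (inj₁ j)

  block₂ : Mat b
  block₂ i j = C (inj₂ i) (inj₂ j)

  private
    row : ∀ s (x : Fin (a + b) → Bool) → ⨁ (λ j → C s (splitAt a j) ∧ x j)
          ≡ ⨁ (λ j → C s (inj₁ j) ∧ x (j ↑ˡ b)) xor ⨁ (λ j → C s (inj₂ j) ∧ x (a ↑ʳ j))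
    row s x = trans (⨁-splitAt a _) (cong₂ _xor_
      (⨁-cong (λ j → cong (λ t → C s t ∧ x (j ↑ˡ b)) (splitAt-↑ˡ a j b)))
      (⨁-cong (λ j → cong (λ t → C s t ∧ x (a ↑ʳ j)) (splitAt-↑ʳ a b j))))

    row₁ : ∀ i x → ⨁ (λ j → blocks (i ↑ˡ b) j ∧ x j) ≡ ⨁ (λ j → block₁ i j ∧ x (j ↑ˡ b))
    row₁ i x rewrite splitAt-↑ˡ a i b = trans (row (inj₁ i) x)
      (trans (cong (⨁ (λ j → block₁ i j ∧ x (j ↑ˡ b)) xor_)
                   (⨁-false _ (λ j → cong (_∧ x (a ↑ʳ j)) (C₁₂≡false i j))))
             (xor-identityʳ _))

    row₂ : ∀ i x → ⨁ (λ j → blocks (a ↑ʳ i) j ∧ x j) ≡ ⨁ (λ j → block₂ i j ∧ x (a ↑ʳ j))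
    row₂ i x rewrite splitAt-↑ʳ a b i = trans (row (inj₂ i) x)
      (cong (_xor ⨁ (λ j → block₂ i j ∧ x (a ↑ʳ j)))
            (⨁-false _ (λ j → cong (_∧ x (j ↑ˡ b)) (C₂₁≡false i j))))

    kernel-restrict₁ : ∀ x → InKernel blocks x → InKernel block₁ (λ j → x (j ↑ˡ b))
    kernel-restrict₁ x x∈ker i = trans (sym (row₁ i x)) (x∈ker (i ↑ˡ b))

    kernel-restrict₂ : ∀ x → InKernel blocks x → InKernel block₂ (λ j → x (a ↑ʳ j))
    kernel-restrict₂ x x∈ker i = trans (sym (row₂ i x)) (x∈ker (a ↑ʳ i))

    kernel-++ : ∀ x₁ x₂ → InKernel block₁ x₁ → InKernel block₂ x₂ → InKernel blocks (x₁ Vector.++ x₂)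
    kernel-++ x₁ x₂ x₁∈ker x₂∈ker = Fin-+-elim _
      (λ i → trans (row₁ i x) (trans (⨁-cong (λ j → cong (block₁ i j ∧_) (lookup-++ˡ x₁ x₂ j))) (x₁∈ker i)))
      (λ i → trans (row₂ i x) (trans (⨁-cong (λ j → cong (block₂ i j ∧_) (lookup-++ʳ x₁ x₂ j))) (x₂∈ker i)))
      where x = x₁ Vector.++ x₂

    trivial-blocks : KernelTrivial block₁ → KernelTrivial block₂ → KernelTrivial blocks
    trivial-blocks trivial₁ trivial₂ x x∈ker = Fin-+-elim _
      (trivial₁ _ (kernel-restrict₁ x x∈ker)) (trivial₂ _ (kernel-restrict₂ x x∈ker))

    trivial-block₁ : KernelTrivial blocks → KernelTrivial block₁
    trivial-block₁ trivial x₁ x₁∈ker j = trans (sym (lookup-++ˡ x₁ zeros j))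
      (trivial _ (kernel-++ x₁ zeros x₁∈ker (λ i → ⨁-false _ (λ j → ∧-zeroʳ (block₂ i j)))) (j ↑ˡ b))
      where
      zeros : Fin b → Bool
      zeros _ = false

    trivial-block₂ : KernelTrivial blocks → KernelTrivial block₂
    trivial-block₂ trivial x₂ x₂∈ker j = trans (sym (lookup-++ʳ zeros x₂ j))
      (trivial _ (kernel-++ zeros x₂ (λ i → ⨁-false _ (λ j → ∧-zeroʳ (block₁ i j))) x₂∈ker) (a ↑ʳ j))
      where
      zeros : Fin a → Bool
      zeros _ = false

  nondegenerate?-blockDiagonal : nondegenerate? blocks ≡ nondegenerate? block₁ ∧ nondegenerate? block₂
  nondegenerate?-blockDiagonal = Bool-ext
    (λ nd → let trivial = nondegenerate?⇒kernelTrivial blocks nd in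
      cong₂ _∧_ (kernelTrivial⇒nondegenerate? block₁ (trivial-block₁ trivial))
                (kernelTrivial⇒nondegenerate? block₂ (trivial-block₂ trivial)))
    (λ nd → let (nd₁ , nd₂) = ∧-true nd in kernelTrivial⇒nondegenerate? blocks
      (trivial-blocks (nondegenerate?⇒kernelTrivial block₁ nd₁) (nondegenerate?⇒kernelTrivial block₂ nd₂)))

-- Alternating matrices of odd size are degenerate

Alternating : ∀ {m} → Mat m → Set
Alternating M = (∀ i → M i i ≡ false) × (∀ i j → M i j ≡ M j i)

zeroRow⇒nonzeroKernelVector : ∀ {m} (M : Mat (suc m)) → Alternating M →
  (∀ k → M zero (suc k) ≡ false) → NonzeroKernelVector M
zeroRow⇒nonzeroKernelVector {m} M (M-irrefl , M-sym) row₀≡0 = e₀ , e₀∈ker , zero , refl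
  where
  e₀ : Fin (suc m) → Bool
  e₀ zero    = true
  e₀ (suc _) = false

  column₀≡0 : ∀ i → M i zero ≡ false
  column₀≡0 zero    = M-irrefl zero
  column₀≡0 (suc i) = trans (M-sym (suc i) zero) (row₀≡0 i)

  e₀∈ker : InKernel M e₀
  e₀∈ker i = cong₂ _xor_ (trans (∧-identityʳ (M i zero)) (column₀≡0 i)) (⨁-false _ (λ j → ∧-zeroʳ (M i (suc j))))

-- Eliminating the rows and columns 0 and K through the pivot block [[0,1],[1,0]], which is its own
-- inverse, leaves the alternating Schur complement; kernel vectors of it extend to kernel vectors of M.
module SchurComplement {n} (M : Mat (suc (suc n))) (alt : Alternating M)
                       (k : Fin (suc n)) (pivot : M zero (suc k) ≡ true) where

  private
    K : Fin (suc (suc n))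
    K = suc k

    g : Fin n → Fin (suc (suc n))
    g i = suc (punchIn k i)

    M-irrefl : ∀ i → M i i ≡ false
    M-irrefl = proj₁ alt

    M-sym : ∀ i j → M i j ≡ M j i
    M-sym = proj₂ alt

  schur : Mat n
  schur i j = M (g i) (g j) xor ((M (g i) zero ∧ M K (g j)) xor (M (g i) K ∧ M zero (g j)))

  schur-alternating : Alternating schur
  schur-alternating = schur-irrefl , schur-sym
    where
    schur-irrefl : ∀ i → schur i i ≡ false
    schur-irrefl i = cong₂ _xor_ (M-irrefl (g i)) (begin
      (M (g i) zero ∧ M K (g i)) xor (M (g i) K ∧ M zero (g i))
        ≡⟨ cong₂ (λ p q → (M (g i) zero ∧ p) xor (M (g i) K ∧ q)) (M-sym K (g i)) (M-sym zero (g i)) ⟩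
      (M (g i) zero ∧ M (g i) K) xor (M (g i) K ∧ M (g i) zero)
        ≡⟨ cong (_xor (M (g i) K ∧ M (g i) zero)) (∧-comm (M (g i) zero) (M (g i) K)) ⟩
      (M (g i) K ∧ M (g i) zero) xor (M (g i) K ∧ M (g i) zero)
        ≡⟨ xor-same (M (g i) K ∧ M (g i) zero) ⟩
      false ∎)
      where open ≡-Reasoning

    schur-sym : ∀ i j → schur i j ≡ schur j i
    schur-sym i j = cong₂ _xor_ (M-sym (g i) (g j)) (begin
      (M (g i) zero ∧ M K (g j)) xor (M (g i) K ∧ M zero (g j))
        ≡⟨ xor-comm (M (g i) zero ∧ M K (g j)) (M (g i) K ∧ M zero (g j)) ⟩
      (M (g i) K ∧ M zero (g j)) xor (M (g i) zero ∧ M K (g j))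
        ≡⟨ cong₂ _xor_ (trans (∧-comm (M (g i) K) (M zero (g j))) (cong₂ _∧_ (M-sym zero (g j)) (M-sym (g i) K)))
                       (trans (∧-comm (M (g i) zero) (M K (g j))) (cong₂ _∧_ (M-sym K (g j)) (M-sym (g i) zero))) ⟩
      (M (g j) zero ∧ M K (g i)) xor (M (g j) K ∧ M zero (g i)) ∎)
      where open ≡-Reasoning

  module Extension (y : Fin n → Bool) where

    s t : Bool
    s = ⨁ (λ i → M zero (g i) ∧ y i)
    t = ⨁ (λ i → M K (g i) ∧ y i)

    extension : Fin (suc (suc n)) → Bool
    extension zero    = t
    extension (suc j) = Vector.insertAt y k s j

    row-expansion : ∀ r → ⨁ (λ j → M r j ∧ extension j)
                        ≡ (M r zero ∧ t) xor ((M r K ∧ s) xor ⨁ (λ i → M r (g i) ∧ y i))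
    row-expansion r = cong ((M r zero ∧ t) xor_) (trans (⨁-remove {i = k} (λ j → M r (suc j) ∧ extension (suc j)))
      (cong₂ _xor_ (cong (M r K ∧_) (insertAt-lookup y k s))
                   (⨁-cong (λ i → cong (M r (g i) ∧_) (insertAt-punchIn y k s i)))))

    schur-row : ∀ r → ⨁ (λ i → schur r i ∧ y i)
                    ≡ ⨁ (λ i → M (g r) (g i) ∧ y i) xor ((M (g r) zero ∧ t) xor (M (g r) K ∧ s))
    schur-row r = begin
      ⨁ (λ i → schur r i ∧ y i)
        ≡⟨ ⨁-cong (λ i → distrib (M (g r) (g i)) (M (g r) zero) (M K (g i)) (M (g r) K) (M zero (g i)) (y i)) ⟩
      ⨁ (λ i → a i xor (b i xor c i))  ≡⟨ ⨁-distrib-xor a (λ i → b i xor c i) ⟩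
      ⨁ a xor ⨁ (λ i → b i xor c i)    ≡⟨ cong (⨁ a xor_) (⨁-distrib-xor b c) ⟩
      ⨁ a xor (⨁ b xor ⨁ c)
        ≡⟨ cong (⨁ a xor_) (sym (cong₂ _xor_ (∧-distribˡ-⨁ (M (g r) zero) (λ i → M K (g i) ∧ y i))
                                                (∧-distribˡ-⨁ (M (g r) K) (λ i → M zero (g i) ∧ y i)))) ⟩
      ⨁ a xor ((M (g r) zero ∧ t) xor (M (g r) K ∧ s)) ∎
      where
      open ≡-Reasoning
      a b c : Fin n → Bool
      a i = M (g r) (g i) ∧ y i
      b i = M (g r) zero ∧ (M K (g i) ∧ y i)
      c i = M (g r) K ∧ (M zero (g i) ∧ y i)
      distrib : ∀ a u v w z y →
        (a xor ((u ∧ v) xor (w ∧ z))) ∧ y ≡ (a ∧ y) xor ((u ∧ (v ∧ y)) xor (w ∧ (z ∧ y)))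
      distrib a u v w z y = trans (∧-distribʳ-xor y a _)
        (cong ((a ∧ y) xor_) (trans (∧-distribʳ-xor y (u ∧ v) (w ∧ z)) (cong₂ _xor_ (∧-assoc u v y) (∧-assoc w z y))))

    extension∈ker : InKernel schur y → InKernel M extension
    extension∈ker y∈ker zero = begin
      ⨁ (λ j → M zero j ∧ extension j)         ≡⟨ row-expansion zero ⟩
      (M zero zero ∧ t) xor ((M zero K ∧ s) xor s)
        ≡⟨ cong₂ (λ p q → (p ∧ t) xor ((q ∧ s) xor s)) (M-irrefl zero) pivot ⟩
      s xor s                                    ≡⟨ xor-same s ⟩
      false                                      ∎
      where open ≡-Reasoning
    extension∈ker y∈ker (suc j) with k ≟ᶠ j
    ... | yes refl = begin
      ⨁ (λ j → M K j ∧ extension j)         ≡⟨ row-expansion K ⟩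
      (M K zero ∧ t) xor ((M K K ∧ s) xor t)
        ≡⟨ cong₂ (λ p q → (p ∧ t) xor ((q ∧ s) xor t)) (trans (M-sym K zero) pivot) (M-irrefl K) ⟩
      t xor t                                 ≡⟨ xor-same t ⟩
      false                                   ∎
      where open ≡-Reasoning
    ... | no k≢j =
      subst (λ l → ⨁ (λ j → M (suc l) j ∧ extension j) ≡ false) (punchIn-punchOut k≢j) (row-g (punchOut k≢j))
      where
      row-g : ∀ r → ⨁ (λ j → M (g r) j ∧ extension j) ≡ false
      row-g r = begin
        ⨁ (λ j → M (g r) j ∧ extension j)                     ≡⟨ row-expansion (g r) ⟩
        Pᵣ xor (Qᵣ xor Σr)                                     ≡⟨ sym (xor-assoc Pᵣ Qᵣ Σr) ⟩
        (Pᵣ xor Qᵣ) xor Σr                                     ≡⟨ xor-comm (Pᵣ xor Qᵣ) Σr ⟩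
        Σr xor (Pᵣ xor Qᵣ)                                     ≡⟨ sym (schur-row r) ⟩
        ⨁ (λ i → schur r i ∧ y i)                             ≡⟨ y∈ker r ⟩
        false                                                  ∎
        where
        open ≡-Reasoning
        Pᵣ Qᵣ Σr : Bool
        Pᵣ = M (g r) zero ∧ t
        Qᵣ = M (g r) K ∧ s
        Σr = ⨁ (λ i → M (g r) (g i) ∧ y i)

  extend : NonzeroKernelVector schur → NonzeroKernelVector M
  extend (y , y∈ker , j , yⱼ≡true) =
    extension , extension∈ker y∈ker , g j , trans (insertAt-punchIn y k s j) yⱼ≡true
    where open Extension y

odd-alternating⇒nonzeroKernelVector : ∀ {m} → m % 2 ≡ 1 → (M : Mat m) → Alternating M → NonzeroKernelVector M
odd-alternating⇒nonzeroKernelVector {suc zero} _ M alt = zeroRow⇒nonzeroKernelVector M alt (λ ())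
odd-alternating⇒nonzeroKernelVector {suc (suc m)} odd M alt with any? (λ k → M zero (suc k) ≟ᵇ true)
... | yes (k , pivot) = extend (odd-alternating⇒nonzeroKernelVector odd schur schur-alternating)
  where open SchurComplement M alt k pivot
... | no noPivot = zeroRow⇒nonzeroKernelVector M alt (λ k → ¬-not (λ pivot → noPivot (k , pivot)))

alternating-nondegenerate⇒even : ∀ {m} (M : Mat m) → Alternating M → nondegenerate? M ≡ true → m % 2 ≡ 0
alternating-nondegenerate⇒even {m} M alt nd with m % 2 in m%2≡r | m%n<n m 2
... | zero          | _ = refl
... | suc zero      | _ =
  let x , x∈ker , j , xⱼ≡true = odd-alternating⇒nonzeroKernelVector m%2≡r M alt
  in ⊥-elim (true≢false (trans (sym xⱼ≡true) (nondegenerate?⇒kernelTrivial M nd x x∈ker j)))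
  where
  true≢false : true ≢ false
  true≢false ()
... | suc (suc _)   | s≤s (s≤s ())

submatrix : ∀ {n} → Mat n → (L : List (Fin n)) → Mat (length L)
submatrix A L i j = A (List.lookup L i) (List.lookup L j)

submatrix-alternating : ∀ {n} {A : Mat n} → Alternating A → ∀ L → Alternating (submatrix A L)
submatrix-alternating (A-irrefl , A-sym) L =
  (λ i → A-irrefl (List.lookup L i)) , (λ i j → A-sym (List.lookup L i) (List.lookup L j))

nondegenerate?-submatrix-allFin : ∀ {n} (A : Mat n) → nondegenerate? (submatrix A (List.allFin n)) ≡ nondegenerate? A
nondegenerate?-submatrix-allFin {n} A = sym (nondegenerate?-cast (sym (length-tabulate id)) λ i j →
  sym (cong₂ A (lookup-tabulate id i) (lookup-tabulate id j)))

lookup-map : ∀ (f : X → Y) (L : List X) i →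
  List.lookup (List.map f L) i ≡ f (List.lookup L (cast (length-map f L) i))
lookup-map f (x ∷ L) zero    = refl
lookup-map f (x ∷ L) (suc i) = lookup-map f L i

nondegenerate?-submatrix-map : ∀ {n k} {A : Mat n} {B : Mat k} (f : Fin k → Fin n) →
  (∀ x y → A (f x) (f y) ≡ B x y) → ∀ L → nondegenerate? (submatrix A (List.map f L)) ≡ nondegenerate? (submatrix B L)
nondegenerate?-submatrix-map {A = A} f A∘f≡B L = nondegenerate?-cast (length-map f L) λ i j →
  trans (cong₂ A (lookup-map f L i) (lookup-map f L j)) (A∘f≡B (List.lookup L _) (List.lookup L _))

lookup-++ : ∀ (L₁ L₂ : List X) i → List.lookup (L₁ List.++ L₂) i
            ≡ [ List.lookup L₁ , List.lookup L₂ ]′ (splitAt (length L₁) (cast (length-++ L₁) i))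
lookup-++ []       L₂ i       = cong (List.lookup L₂) (sym (cast-is-id refl i))
lookup-++ (x ∷ L₁) L₂ zero    = refl
lookup-++ (x ∷ L₁) L₂ (suc i) with splitAt (length L₁) (cast (length-++ L₁) i) | lookup-++ L₁ L₂ i
... | inj₁ _ | eq = eq
... | inj₂ _ | eq = eq

nondegenerate?-submatrix-++ : ∀ {n} (A : Mat n) (L₁ L₂ : List (Fin n)) →
  (∀ i j → A (List.lookup L₁ i) (List.lookup L₂ j) ≡ false) →
  (∀ i j → A (List.lookup L₂ i) (List.lookup L₁ j) ≡ false) →
  nondegenerate? (submatrix A (L₁ List.++ L₂)) ≡ nondegenerate? (submatrix A L₁) ∧ nondegenerate? (submatrix A L₂)
nondegenerate?-submatrix-++ {n} A L₁ L₂ A₁₂≡false A₂₁≡false =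
  trans (nondegenerate?-cast (length-++ L₁) λ i j → cong₂ A (lookup-++ L₁ L₂ i) (lookup-++ L₁ L₂ j))
        (BlockDiagonal.nondegenerate?-blockDiagonal (λ s t → A (vertex s) (vertex t)) A₁₂≡false A₂₁≡false)
  where
  vertex : Fin (length L₁) ⊎ Fin (length L₂) → Fin n
  vertex = [ List.lookup L₁ , List.lookup L₂ ]′

support : ∀ {n} → Vec Bool n → List (Fin n)
support []          = []
support (true ∷ U)  = zero ∷ List.map suc (support U)
support (false ∷ U) = List.map suc (support U)

coCard : ∀ {n} → Vec Bool n → ℕ
coCard []          = 0
coCard (true ∷ U)  = coCard U
coCard (false ∷ U) = suc (coCard U)

filter-map-suc : ∀ {n} b (U : Vec Bool n) L →
  List.filter (λ i → lookup (b ∷ U) i ≟ᵇ true) (List.map suc L)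
  ≡ List.map suc (List.filter (λ i → lookup U i ≟ᵇ true) L)
filter-map-suc b U []      = refl
filter-map-suc b U (j ∷ L) with lookup U j
... | true  = cong (suc j ∷_) (filter-map-suc b U L)
... | false = filter-map-suc b U L

members≡support : ∀ {n} (U : Vec Bool n) → members U ≡ support U

filter-tail≡support : ∀ {n} b (U : Vec Bool n) →
  List.filter (λ i → lookup (b ∷ U) i ≟ᵇ true) (List.tabulate suc) ≡ List.map suc (support U)
filter-tail≡support {n} b U = begin
  List.filter (λ i → lookup (b ∷ U) i ≟ᵇ true) (List.tabulate suc)
    ≡⟨ cong (List.filter _) (map-tabulate id suc) ⟨
  List.filter (λ i → lookup (b ∷ U) i ≟ᵇ true) (List.map suc (List.allFin n))
    ≡⟨ filter-map-suc b U (List.allFin n) ⟩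
  List.map suc (members U)
    ≡⟨ cong (List.map suc) (members≡support U) ⟩
  List.map suc (support U) ∎
  where open ≡-Reasoning

members≡support []          = refl
members≡support (true ∷ U)  = cong (zero ∷_) (filter-tail≡support true U)
members≡support (false ∷ U) = filter-tail≡support false U

length-support : ∀ {n} (U : Vec Bool n) → length (support U) ≡ card U
length-support []          = refl
length-support (true ∷ U)  = cong suc (trans (length-map suc (support U)) (length-support U))
length-support (false ∷ U) = trans (length-map suc (support U)) (length-support U)

card+coCard : ∀ {n} (U : Vec Bool n) → card U + coCard U ≡ n
card+coCard []          = refl
card+coCard (true ∷ U)  = cong suc (card+coCard U)
card+coCard (false ∷ U) = trans (+-suc (card U) (coCard U)) (cong suc (card+coCard U))

card≤ : ∀ {n} (U : Vec Bool n) → card U ≤ n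
card≤ U = subst (card U ≤_) (card+coCard U) (m≤m+n (card U) (coCard U))

coCard≤ : ∀ {n} (U : Vec Bool n) → coCard U ≤ n
coCard≤ U = subst (coCard U ≤_) (card+coCard U) (m≤n+m (coCard U) (card U))

coCard-++ : ∀ {a b} (U₁ : Vec Bool a) (U₂ : Vec Bool b) → coCard (U₁ ++ U₂) ≡ coCard U₁ + coCard U₂
coCard-++ []          U₂ = refl
coCard-++ (true ∷ U₁)  U₂ = coCard-++ U₁ U₂
coCard-++ (false ∷ U₁) U₂ = cong suc (coCard-++ U₁ U₂)

map-suc-++ : ∀ {a b} (L₁ : List (Fin a)) (L₂ : List (Fin b)) →
  List.map suc (List.map (_↑ˡ b) L₁ List.++ List.map (a ↑ʳ_) L₂)
  ≡ List.map (_↑ˡ b) (List.map suc L₁) List.++ List.map (suc a ↑ʳ_) L₂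
map-suc-++ {a} {b} L₁ L₂ = trans (map-++ suc (List.map (_↑ˡ b) L₁) (List.map (a ↑ʳ_) L₂)) (cong₂ List._++_
  (trans (sym (map-∘ {g = suc} {f = _↑ˡ b} L₁)) (map-∘ {g = _↑ˡ b} {f = suc} L₁))
  (sym (map-∘ {g = suc} {f = a ↑ʳ_} L₂)))

support-++ : ∀ {a b} (U₁ : Vec Bool a) (U₂ : Vec Bool b) →
  support (U₁ ++ U₂) ≡ List.map (_↑ˡ b) (support U₁) List.++ List.map (a ↑ʳ_) (support U₂)
support-++ []           U₂ = sym (map-id (support U₂))
support-++ (true ∷ U₁)  U₂ =
  cong (zero ∷_) (trans (cong (List.map suc) (support-++ U₁ U₂)) (map-suc-++ (support U₁) (support U₂)))
support-++ (false ∷ U₁) U₂ = trans (cong (List.map suc) (support-++ U₁ U₂)) (map-suc-++ (support U₁) (support U₂))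

sumOver : List X → (X → ℕ) → ℕ
sumOver L f = NatList.sum (List.map f L)

sumOver-cong : ∀ (L : List X) {f g : X → ℕ} → (∀ x → f x ≡ g x) → sumOver L f ≡ sumOver L g
sumOver-cong []      f≡g = refl
sumOver-cong (x ∷ L) f≡g = cong₂ _+_ (f≡g x) (sumOver-cong L f≡g)

sumOver-zero : ∀ (L : List X) {f : X → ℕ} → (∀ x → f x ≡ 0) → sumOver L f ≡ 0
sumOver-zero L f≡0 = trans (sumOver-cong L f≡0) (zeros L)
  where
  zeros : ∀ L → sumOver L (λ _ → 0) ≡ 0
  zeros []      = refl
  zeros (_ ∷ L) = zeros L

sumOver-+ : ∀ (L : List X) (f g : X → ℕ) → sumOver L (λ x → f x + g x) ≡ sumOver L f + sumOver L g
sumOver-+ []      f g = refl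
sumOver-+ (x ∷ L) f g = trans (cong ((f x + g x) +_) (sumOver-+ L f g)) (+-interchange (f x) (g x) _ _)

sumOver-*ˡ : ∀ (L : List X) (f : X → ℕ) c → c * sumOver L f ≡ sumOver L (λ x → c * f x)
sumOver-*ˡ []      f c = *-zeroʳ c
sumOver-*ˡ (x ∷ L) f c = trans (*-distribˡ-+ c (f x) (sumOver L f)) (cong (c * f x +_) (sumOver-*ˡ L f c))

sumOver-*ʳ : ∀ (L : List X) (f : X → ℕ) c → sumOver L f * c ≡ sumOver L (λ x → f x * c)
sumOver-*ʳ L f c = trans (*-comm (sumOver L f) c) (trans (sumOver-*ˡ L f c) (sumOver-cong L (λ x → *-comm c (f x))))

sumOver-comm : ∀ (L : List X) (M : List Y) (F : X → Y → ℕ) →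
  sumOver L (λ x → sumOver M (F x)) ≡ sumOver M (λ y → sumOver L (λ x → F x y))
sumOver-comm []      M F = sym (sumOver-zero M (λ _ → refl))
sumOver-comm (x ∷ L) M F = trans (cong (sumOver M (F x) +_) (sumOver-comm L M F)) (sym (sumOver-+ M (F x) _))

sumSubsets : ∀ n → (Vec Bool n → ℕ) → ℕ
sumSubsets n = sumOver (allVecs n)

sumSubsets-suc : ∀ n (f : Vec Bool (suc n) → ℕ) →
  sumSubsets (suc n) f ≡ sumSubsets n (λ U → f (false ∷ U)) + sumSubsets n (λ U → f (true ∷ U))
sumSubsets-suc n f = trans (pairs (allVecs n)) (sumOver-+ (allVecs n) _ _)
  where
  pairs : ∀ L → sumOver (List.concatMap (λ v → (false ∷ v) ∷ (true ∷ v) ∷ []) L) f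
              ≡ sumOver L (λ U → f (false ∷ U) + f (true ∷ U))
  pairs []      = refl
  pairs (U ∷ L) = trans (sym (+-assoc (f (false ∷ U)) _ _)) (cong ((f (false ∷ U) + f (true ∷ U)) +_) (pairs L))

sumSubsets-++ : ∀ a b (f : Vec Bool (a + b) → ℕ) →
  sumSubsets (a + b) f ≡ sumSubsets a (λ U₁ → sumSubsets b (λ U₂ → f (U₁ ++ U₂)))
sumSubsets-++ zero    b f = sym (+-identityʳ (sumSubsets b f))
sumSubsets-++ (suc a) b f = trans (sumSubsets-suc (a + b) f)
  (trans (cong₂ _+_ (sumSubsets-++ a b _) (sumSubsets-++ a b _)) (sym (sumSubsets-suc a _)))

pos-sumOver : ∀ (L : List X) (F : X → ℤ) (g : X → ℕ) → (∀ x → F x ≡ ℤ.+ g x) →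
  List.foldr ℤ._+_ (ℤ.+ 0) (List.map F L) ≡ ℤ.+ sumOver L g
pos-sumOver []      F g F≡g = refl
pos-sumOver (x ∷ L) F g F≡g = trans (cong₂ ℤ._+_ (F≡g x) (pos-sumOver L F g F≡g)) (sym (pos-+ (g x) (sumOver L g)))

-- The coefficients of Q_G as counts of nondegenerate induced subgraphs

≡ᵇ-true⇒≡ : ∀ {m n} → (m ≡ᵇ n) ≡ true → m ≡ n
≡ᵇ-true⇒≡ {m} {n} eq = ≡ᵇ⇒≡ m n (Equivalence.from T-≡ eq)

≡⇒≡ᵇ-true : ∀ {m n} → m ≡ n → (m ≡ᵇ n) ≡ true
≡⇒≡ᵇ-true {m} {n} eq = Equivalence.to T-≡ (≡⇒≡ᵇ m n eq)

≢⇒≡ᵇ-false : ∀ {m n} → m ≢ n → (m ≡ᵇ n) ≡ false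
≢⇒≡ᵇ-false m≢n = ¬-not (m≢n ∘ ≡ᵇ-true⇒≡)

≡ᵇ-complement : ∀ c z {n j} → c + z ≡ n → j ≤ n → (c ≡ᵇ n ∸ j) ≡ (z ≡ᵇ j)
≡ᵇ-complement c z {n} {j} c+z≡n j≤n = Bool-ext
  (λ c≡ → ≡⇒≡ᵇ-true (begin
    z               ≡⟨ m+n∸m≡n c z ⟨
    c + z ∸ c       ≡⟨ cong₂ _∸_ c+z≡n (≡ᵇ-true⇒≡ {c} c≡) ⟩
    n ∸ (n ∸ j)     ≡⟨ m∸[m∸n]≡n j≤n ⟩
    j               ∎))
  (λ z≡ → ≡⇒≡ᵇ-true (begin
    c               ≡⟨ m+n∸n≡m c z ⟨
    c + z ∸ z       ≡⟨ cong₂ _∸_ c+z≡n (≡ᵇ-true⇒≡ {z} z≡) ⟩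
    n ∸ j           ∎))
  where open ≡-Reasoning

indicator : Bool → ℕ
indicator b = if b then 1 else 0

if-indicator : ∀ b → (if b then ℤ.+ 1 else ℤ.+ 0) ≡ ℤ.+ indicator b
if-indicator true  = refl
if-indicator false = refl

νOn : ∀ {n} → Mat n → List (Fin n) → ℕ
νOn A L = indicator (nondegenerate? (submatrix A L))

ν≡νOn-allFin : ∀ {n} (G : Graph n) → ν G ≡ ℤ.+ νOn (adj G) (List.allFin n)
ν≡νOn-allFin G = trans (if-indicator _) (cong (ℤ.+_ ∘ indicator) (sym (nondegenerate?-submatrix-allFin (adj G))))

sizeSum : ∀ n → ℕ → (List (Fin n) → ℕ) → ℕ
sizeSum n k h = sumSubsets n (λ U → if card U ≡ᵇ k then h (support U) else 0)

q≡sizeSum : ∀ {n} (G : Graph n) k → q G k ≡ ℤ.+ sizeSum n k (νOn (adj G))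
q≡sizeSum {n} G k = pos-sumOver (allVecs n) _ _ λ U → summand (card U ≡ᵇ k) U
  where
  ν-induced : ∀ U → ν (induced G U) ≡ ℤ.+ νOn (adj G) (support U)
  ν-induced U = trans (if-indicator _) (cong (ℤ.+_ ∘ νOn (adj G)) (members≡support U))

  summand : ∀ b U → (if b then ν (induced G U) else ℤ.+ 0) ≡ ℤ.+ (if b then νOn (adj G) (support U) else 0)
  summand true  U = ν-induced U
  summand false U = refl

Q≡q : ∀ {n} (G : Graph n) {j} → j ≤ n → Q G j ≡ q G (n ∸ j)
Q≡q {n} G {j} j≤n with j ≤ᵇ n | ≤⇒≤ᵇ j≤n
... | true | _ = refl

Q-vanishes : ∀ {n} (G : Graph n) {j} → n ℕ.< j → Q G j ≡ ℤ.+ 0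
Q-vanishes {n} G {j} n<j with j ≤ᵇ n in j≤ᵇn
... | true  = ⊥-elim (<⇒≱ n<j (≤ᵇ⇒≤ j n (Equivalence.from T-≡ j≤ᵇn)))
... | false = refl

coeff : ∀ {n} → Mat n → ℕ → ℕ
coeff {n} A j = sumSubsets n (λ U → if coCard U ≡ᵇ j then νOn A (support U) else 0)

coeff-vanishes : ∀ {n} (A : Mat n) {j} → n ℕ.< j → coeff A j ≡ 0
coeff-vanishes {n} A {j} n<j = sumOver-zero (allVecs n) λ U →
  if-cong {y = 0} (≢⇒≡ᵇ-false {coCard U} λ coCard≡j → <⇒≱ n<j (subst (_≤ n) coCard≡j (coCard≤ U)))

Q≡coeff : ∀ {n} (G : Graph n) j → Q G j ≡ ℤ.+ coeff (adj G) j
Q≡coeff {n} G j with j ℕ.≤? n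
... | yes j≤n = begin
  Q G j                                ≡⟨ Q≡q G j≤n ⟩
  q G (n ∸ j)                          ≡⟨ q≡sizeSum G (n ∸ j) ⟩
  ℤ.+ sizeSum n (n ∸ j) (νOn (adj G))  ≡⟨ cong ℤ.+_ (sumOver-cong (allVecs n) λ U →
                                            if-cong (≡ᵇ-complement (card U) (coCard U) (card+coCard U) j≤n)) ⟩
  ℤ.+ coeff (adj G) j                  ∎
  where open ≡-Reasoning
... | no j≰n = trans (Q-vanishes G (≰⇒> j≰n)) (cong ℤ.+_ (sym (coeff-vanishes (adj G) (≰⇒> j≰n))))

sizeSum-0 : ∀ n (h : List (Fin n) → ℕ) → sizeSum n 0 h ≡ h []
sizeSum-0 zero    h = +-identityʳ (h [])
sizeSum-0 (suc n) h = trans (sumSubsets-suc n _)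
  (trans (cong₂ _+_ (sizeSum-0 n (h ∘ List.map suc)) (sumOver-zero (allVecs n) (λ _ → refl))) (+-identityʳ (h [])))

sizeSum-1 : ∀ n (h : List (Fin n) → ℕ) → sizeSum n 1 h ≡ Σᶠ (λ j → h (j ∷ []))
sizeSum-1 zero    h = refl
sizeSum-1 (suc n) h = trans (sumSubsets-suc n _)
  (trans (cong₂ _+_ (sizeSum-1 n (h ∘ List.map suc)) (sizeSum-0 n (λ L → h (zero ∷ List.map suc L))))
         (+-comm (Σᶠ (λ j → h (suc j ∷ []))) (h (zero ∷ []))))

sizeSum-2-suc : ∀ n (h : List (Fin (suc n)) → ℕ) →
  sizeSum (suc n) 2 h ≡ sizeSum n 2 (h ∘ List.map suc) + Σᶠ (λ j → h (zero ∷ suc j ∷ []))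
sizeSum-2-suc n h = trans (sumSubsets-suc n _)
  (cong (sizeSum n 2 (h ∘ List.map suc) +_) (sizeSum-1 n (λ L → h (zero ∷ List.map suc L))))

sizeSum-full : ∀ n (h : List (Fin n) → ℕ) → sizeSum n n h ≡ h (List.allFin n)
sizeSum-full zero    h = +-identityʳ (h [])
sizeSum-full (suc n) h = trans (sumSubsets-suc n _) (cong₂ _+_
  (sumOver-zero (allVecs n) λ U → if-cong {y = 0}
    (≢⇒≡ᵇ-false {card U} λ card≡1+n → <⇒≱ (s≤s ≤-refl) (subst (_≤ n) card≡1+n (card≤ U))))
  (trans (sizeSum-full n (λ L → h (zero ∷ List.map suc L))) (cong (h ∘ (zero ∷_)) (map-tabulate id suc))))

edgesOf : ∀ {n} → Mat n → ℕ
edgesOf A = Σᶠ (λ i → Σᶠ (λ j → if (toℕ i <ᵇ toℕ j) ∧ A i j then 1 else 0))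

sum-concatMap : ∀ (f : X → List ℕ) L → NatList.sum (List.concatMap f L) ≡ sumOver L (NatList.sum ∘ f)
sum-concatMap f []      = refl
sum-concatMap f (x ∷ L) = trans (sum-++ (f x) _) (cong (NatList.sum (f x) +_) (sum-concatMap f L))

sumOver-allFin : ∀ {n} (g : Fin n → ℕ) → sumOver (List.allFin n) g ≡ Σᶠ g
sumOver-allFin g = trans (cong NatList.sum (map-tabulate id g)) (sum-tabulate g)
  where
  sum-tabulate : ∀ {n} (g : Fin n → ℕ) → NatList.sum (List.tabulate g) ≡ Σᶠ g
  sum-tabulate {zero}  g = refl
  sum-tabulate {suc n} g = cong (g zero +_) (sum-tabulate (g ∘ suc))

edgeCount≡edgesOf : ∀ {n} (G : Graph n) → edgeCount G ≡ edgesOf (adj G)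
edgeCount≡edgesOf {n} G = trans (sum-concatMap (λ i → List.map (e i) (List.allFin n)) (List.allFin n))
  (trans (sumOver-allFin (λ i → sumOver (List.allFin n) (e i))) (Σᶠ-cong (λ i → sumOver-allFin (e i))))
  where
  e : Fin n → Fin n → ℕ
  e i j = if (toℕ i <ᵇ toℕ j) ∧ adj G i j then 1 else 0

νOn-pair : ∀ {n} {A : Mat n} → Alternating A → ∀ x y → νOn A (x ∷ y ∷ []) ≡ indicator (A x y)
νOn-pair {A = A} (A-irrefl , A-sym) x y = cong indicator (trans (nondegenerate?-cong entries) (pair-nondegenerate? (A x y)))
  where
  pair : Bool → Mat 2
  pair b zero       zero       = false
  pair b zero       (suc zero) = b
  pair b (suc zero) zero       = b
  pair b (suc zero) (suc zero) = false

  pair-nondegenerate? : ∀ b → nondegenerate? (pair b) ≡ b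
  pair-nondegenerate? false = refl
  pair-nondegenerate? true  = refl

  entries : ∀ i j → submatrix A (x ∷ y ∷ []) i j ≡ pair (A x y) i j
  entries zero       zero       = A-irrefl x
  entries zero       (suc zero) = refl
  entries (suc zero) zero       = A-sym y x
  entries (suc zero) (suc zero) = A-irrefl y

sizeSum-cong : ∀ n k {h h′ : List (Fin n) → ℕ} → (∀ L → h L ≡ h′ L) → sizeSum n k h ≡ sizeSum n k h′
sizeSum-cong n k h≗h′ = sumOver-cong (allVecs n) (λ U → if-cong-then (card U ≡ᵇ k) (h≗h′ (support U)))

sizeSum-2 : ∀ {n} (A : Mat n) → Alternating A → sizeSum n 2 (νOn A) ≡ edgesOf A
sizeSum-2 {zero}  A alt = refl
sizeSum-2 {suc n} A alt@(A-irrefl , A-sym) = begin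
  sizeSum (suc n) 2 (νOn A)
    ≡⟨ sizeSum-2-suc n (νOn A) ⟩
  sizeSum n 2 (νOn A ∘ List.map suc) + Σᶠ (λ j → νOn A (zero ∷ suc j ∷ []))
    ≡⟨ cong₂ _+_ (sizeSum-cong n 2 (cong indicator ∘ nondegenerate?-submatrix-map {A = A} {A₊} suc (λ _ _ → refl)))
                 (Σᶠ-cong (λ j → νOn-pair alt zero (suc j))) ⟩
  sizeSum n 2 (νOn A₊) + Σᶠ (λ j → indicator (A zero (suc j)))
    ≡⟨ cong (_+ Σᶠ (λ j → indicator (A zero (suc j)))) (sizeSum-2 A₊ alt₊) ⟩
  edgesOf A₊ + Σᶠ (λ j → indicator (A zero (suc j)))
    ≡⟨ +-comm (edgesOf A₊) _ ⟩
  edgesOf A ∎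
  where
  open ≡-Reasoning
  A₊ : Mat n
  A₊ i j = A (suc i) (suc j)
  alt₊ : Alternating A₊
  alt₊ = (λ i → A-irrefl (suc i)) , (λ i j → A-sym (suc i) (suc j))

-- Disjoint unions

Σᶠ-indicator : ∀ N a (w : ℕ → ℕ) → Σᶠ {N} (λ i → if a ≡ᵇ toℕ i then w (toℕ i) else 0) ≡ (if a <ᵇ N then w a else 0)
Σᶠ-indicator zero    a       w = refl
Σᶠ-indicator (suc N) zero    w = trans (cong (w 0 +_) (Σᶠ-zero N)) (+-identityʳ (w 0))
Σᶠ-indicator (suc N) (suc a) w = Σᶠ-indicator N a (w ∘ suc)

sumOver-applyUpTo : ∀ (k : ℕ → ℕ) N (f : ℕ → ℕ) → sumOver (List.applyUpTo k N) f ≡ Σᶠ {N} (λ i → f (k (toℕ i)))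
sumOver-applyUpTo k zero    f = refl
sumOver-applyUpTo k (suc N) f = cong (f (k 0) +_) (sumOver-applyUpTo (k ∘ suc) N f)

if-<ᵇ-∸ : ∀ a b m (x : ℕ) → (if a <ᵇ suc m then (if b ≡ᵇ m ∸ a then x else 0) else 0) ≡ (if a + b ≡ᵇ m then x else 0)
if-<ᵇ-∸ zero    b m       x = refl
if-<ᵇ-∸ (suc a) b zero    x = refl
if-<ᵇ-∸ (suc a) b (suc m) x = if-<ᵇ-∸ a b m x

convolution-indicator : ∀ a b (g h : ℕ) m →
  sumOver (List.upTo (suc m)) (λ i → (if a ≡ᵇ i then g else 0) * (if b ≡ᵇ m ∸ i then h else 0))
  ≡ (if a + b ≡ᵇ m then g * h else 0)
convolution-indicator a b g h m = begin
  sumOver (List.upTo (suc m)) (λ i → (if a ≡ᵇ i then g else 0) * (if b ≡ᵇ m ∸ i then h else 0))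
    ≡⟨ sumOver-applyUpTo id (suc m) (λ i → (if a ≡ᵇ i then g else 0) * (if b ≡ᵇ m ∸ i then h else 0)) ⟩
  Σᶠ {suc m} (λ i → (if a ≡ᵇ toℕ i then g else 0) * (if b ≡ᵇ m ∸ toℕ i then h else 0))
    ≡⟨ Σᶠ-cong {suc m} (λ i → if-float (_* (if b ≡ᵇ m ∸ toℕ i then h else 0)) (a ≡ᵇ toℕ i) {g} {0}) ⟩
  Σᶠ {suc m} (λ i → if a ≡ᵇ toℕ i then g * (if b ≡ᵇ m ∸ toℕ i then h else 0) else 0)
    ≡⟨ Σᶠ-indicator (suc m) a (λ i → g * (if b ≡ᵇ m ∸ i then h else 0)) ⟩
  (if a <ᵇ suc m then g * (if b ≡ᵇ m ∸ a then h else 0) else 0)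
    ≡⟨ if-cong-then (a <ᵇ suc m) (trans (if-float (g *_) (b ≡ᵇ m ∸ a)) (if-cong-else (b ≡ᵇ m ∸ a) (*-zeroʳ g))) ⟩
  (if a <ᵇ suc m then (if b ≡ᵇ m ∸ a then g * h else 0) else 0)
    ≡⟨ if-<ᵇ-∸ a b m (g * h) ⟩
  (if a + b ≡ᵇ m then g * h else 0) ∎
  where open ≡-Reasoning

sumOver-convolution : ∀ {X Y : Set} (L₁ : List X) (L₂ : List Y) (z₁ g₁ : X → ℕ) (z₂ g₂ : Y → ℕ) m →
  sumOver L₁ (λ x → sumOver L₂ (λ y → if z₁ x + z₂ y ≡ᵇ m then g₁ x * g₂ y else 0))
  ≡ sumOver (List.upTo (suc m)) (λ i → sumOver L₁ (λ x → if z₁ x ≡ᵇ i then g₁ x else 0)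
                                     * sumOver L₂ (λ y → if z₂ y ≡ᵇ m ∸ i then g₂ y else 0))
sumOver-convolution {X} {Y} L₁ L₂ z₁ g₁ z₂ g₂ m = sym (begin
  sumOver I (λ i → sumOver L₁ (F₁ i) * sumOver L₂ (F₂ i))
    ≡⟨ sumOver-cong I (λ i → trans (sumOver-*ʳ L₁ (F₁ i) _) (sumOver-cong L₁ (λ x → sumOver-*ˡ L₂ (F₂ i) (F₁ i x)))) ⟩
  sumOver I (λ i → sumOver L₁ (λ x → sumOver L₂ (λ y → F₁ i x * F₂ i y)))
    ≡⟨ sumOver-comm I L₁ _ ⟩
  sumOver L₁ (λ x → sumOver I (λ i → sumOver L₂ (λ y → F₁ i x * F₂ i y)))
    ≡⟨ sumOver-cong L₁ (λ x → sumOver-comm I L₂ _) ⟩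
  sumOver L₁ (λ x → sumOver L₂ (λ y → sumOver I (λ i → F₁ i x * F₂ i y)))
    ≡⟨ sumOver-cong L₁ (λ x → sumOver-cong L₂ (λ y → convolution-indicator (z₁ x) (z₂ y) (g₁ x) (g₂ y) m)) ⟩
  sumOver L₁ (λ x → sumOver L₂ (λ y → if z₁ x + z₂ y ≡ᵇ m then g₁ x * g₂ y else 0)) ∎)
  where
  open ≡-Reasoning
  I : List ℕ
  I = List.upTo (suc m)
  F₁ : ℕ → X → ℕ
  F₁ i x = if z₁ x ≡ᵇ i then g₁ x else 0
  F₂ : ℕ → Y → ℕ
  F₂ i y = if z₂ y ≡ᵇ m ∸ i then g₂ y else 0

module _ {a b} (G₁ : Graph a) (G₂ : Graph b) where

  private
    A : Mat (a + b)
    A = adj (G₁ ⊔ G₂)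

  adj-⊔-↑ˡ-↑ˡ : ∀ x y → A (x ↑ˡ b) (y ↑ˡ b) ≡ adj G₁ x y
  adj-⊔-↑ˡ-↑ˡ x y rewrite splitAt-↑ˡ a x b | splitAt-↑ˡ a y b = refl

  adj-⊔-↑ʳ-↑ʳ : ∀ x y → A (a ↑ʳ x) (a ↑ʳ y) ≡ adj G₂ x y
  adj-⊔-↑ʳ-↑ʳ x y rewrite splitAt-↑ʳ a b x | splitAt-↑ʳ a b y = refl

  adj-⊔-↑ˡ-↑ʳ : ∀ x y → A (x ↑ˡ b) (a ↑ʳ y) ≡ false
  adj-⊔-↑ˡ-↑ʳ x y rewrite splitAt-↑ˡ a x b | splitAt-↑ʳ a b y = refl

  adj-⊔-↑ʳ-↑ˡ : ∀ x y → A (a ↑ʳ x) (y ↑ˡ b) ≡ false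
  adj-⊔-↑ʳ-↑ˡ x y rewrite splitAt-↑ʳ a b x | splitAt-↑ˡ a y b = refl

  νOn-⊔ : ∀ (U₁ : Vec Bool a) (U₂ : Vec Bool b) →
    νOn A (support (U₁ ++ U₂)) ≡ νOn (adj G₁) (support U₁) * νOn (adj G₂) (support U₂)
  νOn-⊔ U₁ U₂ = begin
    νOn A (support (U₁ ++ U₂))
      ≡⟨ cong (νOn A) (support-++ U₁ U₂) ⟩
    indicator (nondegenerate? (submatrix A (L₁ List.++ L₂)))
      ≡⟨ cong indicator (nondegenerate?-submatrix-++ A L₁ L₂ cross₁₂ cross₂₁) ⟩
    indicator (nondegenerate? (submatrix A L₁) ∧ nondegenerate? (submatrix A L₂))
      ≡⟨ cong indicator (cong₂ _∧_
           (nondegenerate?-submatrix-map {A = A} (_↑ˡ b) adj-⊔-↑ˡ-↑ˡ (support U₁))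
           (nondegenerate?-submatrix-map {A = A} (a ↑ʳ_) adj-⊔-↑ʳ-↑ʳ (support U₂))) ⟩
    indicator (nondegenerate? (submatrix (adj G₁) (support U₁)) ∧ nondegenerate? (submatrix (adj G₂) (support U₂)))
      ≡⟨ indicator-∧ (nondegenerate? (submatrix (adj G₁) (support U₁)))
                     (nondegenerate? (submatrix (adj G₂) (support U₂))) ⟩
    νOn (adj G₁) (support U₁) * νOn (adj G₂) (support U₂) ∎
    where
    open ≡-Reasoning
    L₁ L₂ : List (Fin (a + b))
    L₁ = List.map (_↑ˡ b) (support U₁)
    L₂ = List.map (a ↑ʳ_) (support U₂)
    cross₁₂ : ∀ i j → A (List.lookup L₁ i) (List.lookup L₂ j) ≡ false
    cross₁₂ i j = trans (cong₂ A (lookup-map (_↑ˡ b) (support U₁) i) (lookup-map (a ↑ʳ_) (support U₂) j)) (adj-⊔-↑ˡ-↑ʳ _ _)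
    cross₂₁ : ∀ i j → A (List.lookup L₂ i) (List.lookup L₁ j) ≡ false
    cross₂₁ i j = trans (cong₂ A (lookup-map (a ↑ʳ_) (support U₂) i) (lookup-map (_↑ˡ b) (support U₁) j)) (adj-⊔-↑ʳ-↑ˡ _ _)
    indicator-∧ : ∀ p r → indicator (p ∧ r) ≡ indicator p * indicator r
    indicator-∧ true  r = sym (+-identityʳ (indicator r))
    indicator-∧ false r = refl

  coeff-⊔ : ∀ m → coeff A m ≡ sumOver (List.upTo (suc m)) (λ i → coeff (adj G₁) i * coeff (adj G₂) (m ∸ i))
  coeff-⊔ m = trans (sumSubsets-++ a b _) (trans
    (sumOver-cong (allVecs a) λ U₁ → sumOver-cong (allVecs b) λ U₂ →
      trans (if-cong (cong (_≡ᵇ m) (coCard-++ U₁ U₂))) (if-cong-then (coCard U₁ + coCard U₂ ≡ᵇ m) (νOn-⊔ U₁ U₂)))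
    (sumOver-convolution (allVecs a) (allVecs b) coCard (νOn (adj G₁) ∘ support) coCard (νOn (adj G₂) ∘ support) m))

adj-alternating : ∀ {n} (G : Graph n) → Alternating (adj G)
adj-alternating G = irrefl G , adj-sym G

Q-leading : ∀ {n} (G : Graph n) → Q G n ≡ ℤ.+ 1
Q-leading {n} G = begin
  Q G n                          ≡⟨ Q≡q G ≤-refl ⟩
  q G (n ∸ n)                    ≡⟨ cong (q G) (n∸n≡0 n) ⟩
  q G 0                          ≡⟨ q≡sizeSum G 0 ⟩
  ℤ.+ sizeSum n 0 (νOn (adj G))  ≡⟨ cong ℤ.+_ (sizeSum-0 n (νOn (adj G))) ⟩
  ℤ.+ 1                          ∎
  where open ≡-Reasoning

Q-degree : ∀ {n} (G : Graph n) → Degree (Q G) n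
Q-degree G = (λ Qₙ≡0 → +1≢+0 (trans (sym (Q-leading G)) Qₙ≡0)) , (λ j n<j → Q-vanishes G n<j)
  where
  +1≢+0 : ℤ.+ 1 ≢ ℤ.+ 0
  +1≢+0 ()

Q-edges : ∀ {n} (G : Graph n) → 2 ≤ n → Q G (n ∸ 2) ≡ ℤ.+ edgeCount G
Q-edges {n} G 2≤n = begin
  Q G (n ∸ 2)                    ≡⟨ Q≡q G (m∸n≤m n 2) ⟩
  q G (n ∸ (n ∸ 2))              ≡⟨ cong (q G) (m∸[m∸n]≡n 2≤n) ⟩
  q G 2                          ≡⟨ q≡sizeSum G 2 ⟩
  ℤ.+ sizeSum n 2 (νOn (adj G))  ≡⟨ cong ℤ.+_ (sizeSum-2 (adj G) (adj-alternating G)) ⟩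
  ℤ.+ edgesOf (adj G)            ≡⟨ cong ℤ.+_ (edgeCount≡edgesOf G) ⟨
  ℤ.+ edgeCount G                ∎
  where open ≡-Reasoning

Q-constant : ∀ {n} (G : Graph n) → Q G 0 ≡ ν G
Q-constant {n} G = trans (q≡sizeSum G n) (trans (cong ℤ.+_ (sizeSum-full n (νOn (adj G)))) (sym (ν≡νOn-allFin G)))

Q-nonzero⇒positive : ∀ {n} (G : Graph n) j → Q G j ≢ ℤ.+ 0 → ℤ.+ 0 ℤ.< Q G j
Q-nonzero⇒positive G j Qⱼ≢0 rewrite Q≡coeff G j with coeff (adj G) j
... | zero  = ⊥-elim (Qⱼ≢0 refl)
... | suc _ = ℤ.+<+ (s≤s z≤n)

even+-% : ∀ c z → c % 2 ≡ 0 → (c + z) % 2 ≡ z % 2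
even+-% c z c%2≡0 = begin
  (c + z) % 2              ≡⟨ %-distribˡ-+ c z 2 ⟩
  (c % 2 + z % 2) % 2      ≡⟨ cong (λ r → (r + z % 2) % 2) c%2≡0 ⟩
  z % 2 % 2                ≡⟨ m%n%n≡m%n z 2 ⟩
  z % 2                    ∎
  where open ≡-Reasoning

coeff-parity : ∀ {n} (A : Mat n) → Alternating A → ∀ j → coeff A j ≢ 0 → j % 2 ≡ n % 2
coeff-parity {n} A alt j coeff≢0 with j % 2 ℕ.≟ n % 2
... | yes j≡n = j≡n
... | no  j≢n = ⊥-elim (coeff≢0 (sumOver-zero (allVecs n) summand≡0))
  where
  summand≡0 : ∀ U → (if coCard U ≡ᵇ j then νOn A (support U) else 0) ≡ 0
  summand≡0 U with coCard U ≡ᵇ j in coCard≡j | nondegenerate? (submatrix A (support U)) in nd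
  ... | false | _     = refl
  ... | true  | false = refl
  ... | true  | true  = ⊥-elim (j≢n (begin
    j % 2                  ≡⟨ cong (_% 2) (≡ᵇ-true⇒≡ {coCard U} coCard≡j) ⟨
    coCard U % 2           ≡⟨ even+-% (card U) (coCard U) card-even ⟨
    (card U + coCard U) % 2 ≡⟨ cong (_% 2) (card+coCard U) ⟩
    n % 2                  ∎))
    where
    open ≡-Reasoning
    card-even : card U % 2 ≡ 0
    card-even = subst (λ l → l % 2 ≡ 0) (length-support U)
      (alternating-nondegenerate⇒even _ (submatrix-alternating alt (support U)) nd)

Q-parity : ∀ {n} (G : Graph n) j → Q G j ≢ ℤ.+ 0 → j % 2 ≡ n % 2
Q-parity G j Qⱼ≢0 =
  coeff-parity (adj G) (adj-alternating G) j λ coeff≡0 → Qⱼ≢0 (trans (Q≡coeff G j) (cong ℤ.+_ coeff≡0))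

Q-⊔ : ∀ {a b} (G₁ : Graph a) (G₂ : Graph b) m → Q (G₁ ⊔ G₂) m ≡ (Q G₁ *ₚ Q G₂) m
Q-⊔ G₁ G₂ m = trans (Q≡coeff (G₁ ⊔ G₂) m) (trans (cong ℤ.+_ (coeff-⊔ G₁ G₂ m))
  (sym (pos-sumOver (List.upTo (suc m)) _ _ λ i →
    trans (cong₂ ℤ._*_ (Q≡coeff G₁ i) (Q≡coeff G₂ (m ∸ i)))
          (sym (pos-* (coeff (adj G₁) i) (coeff (adj G₂) (m ∸ i)))))))

Q-singleVertex : ∀ (G : Graph 1) j → Q G j ≡ uₚ j
Q-singleVertex G zero = trans (Q-constant G) (if-cong (nondegenerate?-cong adj≡false))
  where
  adj≡false : ∀ i j → adj G i j ≡ false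
  adj≡false zero zero = irrefl G zero
Q-singleVertex G (suc zero)    = Q-leading G
Q-singleVertex G (suc (suc j)) = Q-vanishes G {suc (suc j)} (s≤s (s≤s z≤n))

import Data.Nat
open import Data.Integer using (+_; _<_)
open import Data.Empty using (⊥)

mainTheorem1 : (∀ {n} (G : Graph n) → Degree (Q G) n)
    × (∀ {n} (G : Graph n) (j : ℕ) → (Q G j ≡ + 0 → ⊥) → j % 2 ≡ n % 2)
    × (∀ {n} (G : Graph n) (j : ℕ) → (Q G j ≡ + 0 → ⊥) → + 0 < Q G j)
    × (∀ {n} (G : Graph n) → Q G n ≡ + 1)
    × (∀ {n} (G : Graph n) → 2 ≤ n → Q G (n Data.Nat.∸ 2) ≡ + edgeCount G)
    × (∀ {n} (G : Graph n) → eval0 (Q G) ≡ ν G)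
    × (∀ {a b} (G₁ : Graph a) (G₂ : Graph b) (m : ℕ) → Q (G₁ ⊔ G₂) m ≡ (Q G₁ *ₚ Q G₂) m)
    × (∀ (G : Graph 1) (j : ℕ) → Q G j ≡ uₚ j)
mainTheorem1 = Q-degree , Q-parity , Q-nonzero⇒positive , Q-leading , Q-edges , Q-constant , Q-⊔ , Q-singleVertex
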